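{- If an s-hypersequent $\alpha_1\vdash\beta_1\mid\dots\mid\alpha_n\vdash\beta_n$ is provable in $\mathbf{MPDBL}$, then it is valid in the class $\mathcal{KC}$ of all Kripke contexts.
   Context: The logic PDBL. Variables: object variables $\mathbf{OV}$ ($p,\dots$) and property variables $\mathbf{PV}$ ($P,\dots$), disjoint countably infinite sets; constants $\top,\bot$; connectives $\sqcap,\sqcup$ (binary), $\neg,\lrcorner$ (unary). $\alpha\vee\beta:=\neg(\neg\alpha\sqcap\neg\beta)$, $\alpha\wedge\beta:=\lrcorner(\lrcorner\alpha\sqcup\lrcorner\beta)$. Sequents $\alpha\vdash\beta$ ($\alpha\dashv\vdash\beta$ means both directions); s-hypersequents are finite sequences $\alpha_1\vdash\beta_1\mid\dots\mid\alpha_n\vdash\beta_n$ (components); $B,C,\dots,X$ range over possibly empty s-hypersequents. Axioms: $\alpha\vdash\alpha$; $\alpha\sqcap\beta\vdash\alpha$; $\alpha\sqcap\beta\vdash\beta$; $\alpha\vdash\alpha\sqcup\beta$; $\beta\vdash\alpha\sqcup\beta$; $\alpha\sqcap\beta\vdash(\alpha\sqcap\beta)\sqcap(\alpha\sqcap\beta)$; $(\alpha\sqcup\beta)\sqcup(\alpha\sqcup\beta)\vdash\alpha\sqcup\beta$; $\neg(\alpha\sqcap\alpha)\vdash\neg\alpha$; $\lrcorner\alpha\vdash\lrcorner(\alpha\sqcup\alpha)$; $\alpha\sqcap\neg\alpha\vdash\bot$; $\top\vdash\alpha\sqcup\lrcorner\alpha$; $\neg\neg(\alpha\sqcap\beta)\dashv\vdash\alpha\sqcap\beta$;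 $\lrcorner\lrcorner(\alpha\sqcup\beta)\dashv\vdash\alpha\sqcup\beta$; $\alpha\sqcap\alpha\vdash\alpha\sqcap(\alpha\sqcup\beta)$; $\alpha\sqcup(\alpha\sqcap\beta)\vdash\alpha\sqcup\alpha$; $\alpha\sqcap\alpha\vdash\alpha\sqcap(\alpha\vee\beta)$; $\alpha\sqcup(\alpha\wedge\beta)\vdash\alpha\sqcup\alpha$; $\alpha\sqcap(\beta\vee\gamma)\dashv\vdash(\alpha\sqcap\beta)\vee(\alpha\sqcap\gamma)$; $\alpha\sqcup(\beta\wedge\gamma)\dashv\vdash(\alpha\sqcup\beta)\wedge(\alpha\sqcup\gamma)$; $\bot\vdash\alpha$; $\alpha\vdash\top$; $\neg\top\vdash\bot$; $\top\vdash\lrcorner\bot$; $\neg\bot\dashv\vdash\top\sqcap\top$; $\lrcorner\top\dashv\vdash\bot\sqcup\bot$; $(\alpha\sqcup\alpha)\sqcap(\alpha\sqcup\alpha)\dashv\vdash(\alpha\sqcap\alpha)\sqcup(\alpha\sqcap\alpha)$; $p\sqcap p\dashv\vdash p$ ($p\in\mathbf{OV}$); $P\sqcup P\dashv\vdash P$ ($P\in\mathbf{PV}$); (Sp) $\alpha\vdash\alpha\sqcap\alpha\mid\alpha\sqcup\alpha\vdash\alpha$. Rules: from $B\mid\alpha\vdash\beta\mid C$ infer $B\mid\alpha\sqcap\gamma\vdash\beta\sqcap\gamma\mid C$, $B\mid\gamma\sqcap\alpha\vdash\gamma\sqcap\beta\mid C$, $B\mid\alpha\sqcup\gamma\vdash\beta\sqcup\gamma\mid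 C$, $B\mid\gamma\sqcup\alpha\vdash\gamma\sqcup\beta\mid C$, $B\mid\neg\beta\vdash\neg\alpha\mid C$, $B\mid\lrcorner\beta\vdash\lrcorner\alpha\mid C$; from $B\mid\alpha\vdash\beta\mid C$ and $D\mid\beta\vdash\gamma\mid E$ infer $B\mid D\mid\alpha\vdash\gamma\mid C\mid E$; from $B\mid\alpha\sqcap\beta\vdash\alpha\sqcap\alpha\mid C$, $D\mid\alpha\sqcap\alpha\vdash\alpha\sqcap\beta\mid E$, $F\mid\alpha\sqcup\beta\vdash\beta\sqcup\beta\mid G$, $H\mid\beta\sqcup\beta\vdash\alpha\sqcup\beta\mid X$ infer $B\mid D\mid F\mid H\mid\alpha\vdash\beta\mid C\mid E\mid G\mid X$; external: from $B\mid D\mid D\mid C$ infer $B\mid D\mid C$; from $B\mid D\mid E\mid C$ infer $B\mid E\mid D\mid C$; from $B$ infer $B\mid C$. MPDBL. Add unary connectives $\square,\blacksquare$ (the PDBL schemes and rules range over all formulae of the enlarged language), with additional axioms $\square\alpha\sqcap\square\beta\dashv\vdash\square(\alpha\sqcap\beta)$; $\blacksquare\alpha\sqcup\blacksquare\beta\dashv\vdash\blacksquare(\alpha\sqcup\beta)$; $\square(\neg\bot)\dashv\vdash\neg\bot$; $\blacksquare(\lrcorner\top)\dashv\vdash\lrcorner\top$; $\square(\alpha\sqcap\alpha)\dashv\vdash\square\alpha$; $\blacksquare(\alpha\sqcup\alpha)\dashv\vdash\blacksquare\alpha$, and rules: from $B\mid\alpha\vdash\beta\mid C$ infer $B\mid\square\alpha\vdash\square\beta\mid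 C$ and $B\mid\blacksquare\alpha\vdash\blacksquare\beta\mid C$. Provability is via finite derivations. Kripke contexts and semiconcepts. A Kripke context is $\mathbb{KC}=((G,R),(M,S),I)$ where $(G,M,I)$ is a context ($I\subseteq G\times M$), $R$ is a binary relation on $G$ and $S$ a binary relation on $M$. For $A\subseteq G$, $A'=\{m:gIm\ \forall g\in A\}$; for $B\subseteq M$, $B'=\{g:gIm\ \forall m\in B\}$. A semiconcept of $(G,M,I)$ is a pair $(A,B)$ with $A'=B$ or $B'=A$; $ext(A,B)=A$, $int(A,B)=B$; $\mathfrak{H}$ denotes the set of semiconcepts with operations $(A_1,B_1)\sqcap(A_2,B_2)=(A_1\cap A_2,(A_1\cap A_2)')$, $(A_1,B_1)\sqcup(A_2,B_2)=((B_1\cap B_2)',B_1\cap B_2)$. Models. A model is $\mathbb{M}=(\mathbb{KC},v)$ with $v$ a map on $\mathbf{OV}\cup\mathbf{PV}\cup\{\top,\bot\}$ into $\mathfrak{H}$ with $v(p)\sqcap v(p)=v(p)$ ($p\in\mathbf{OV}$), $v(P)\sqcup v(P)=v(P)$ ($P\in\mathbf{PV}$), $v(\top)=(G,\emptyset)$, $v(\bot)=(\emptyset,M)$. Satisfaction $g\models\alpha$ ($g\in G$) and co-satisfaction $m\succ\alpha$ ($m\in M$): $g\models p$ iff $g\in ext(v(p))$; $g\models P$ iff $g\in ext(v(P))$; $g\models\top$ always; $g\not\models\bot$ always; $m\not\succ\top$ always; $m\succ\bot$ always; $g\models\alpha\sqcap\beta$ iff $g\models\alpha$ and $g\models\beta$;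 $g\models\neg\alpha$ iff $g\not\models\alpha$; $m\succ p$ iff $m\in int(v(p))$; $m\succ P$ iff $m\in int(v(P))$; $m\succ\alpha\sqcup\beta$ iff $m\succ\alpha$ and $m\succ\beta$; $m\succ\lrcorner\alpha$ iff $m\not\succ\alpha$; $g\models\alpha\sqcup\beta$ iff $\forall m(m\succ\alpha\sqcup\beta\Rightarrow gIm)$; $g\models\lrcorner\alpha$ iff $\forall m(m\not\succ\alpha\Rightarrow gIm)$; $m\succ\neg\alpha$ iff $\forall g(g\not\models\alpha\Rightarrow gIm)$; $m\succ\alpha\sqcap\beta$ iff $\forall g(g\models\alpha\sqcap\beta\Rightarrow gIm)$; $g\models\square\alpha$ iff for all $g_1$ with $gRg_1$, $g_1\models\alpha$; $m\succ\square\alpha$ iff $gIm$ for every $g\in G$ such that ($g_1\models\alpha$ for all $g_1$ with $gRg_1$); $m\succ\blacksquare\alpha$ iff for all $m_1$ with $mSm_1$, $m_1\succ\alpha$; $g\models\blacksquare\alpha$ iff $gIm$ for every $m\in M$ such that ($m_1\succ\alpha$ for all $m_1$ with $mSm_1$). A sequent $\alpha\vdash\beta$ is satisfied in $\mathbb{M}$ iff $\forall g(g\models\alpha\Rightarrow g\models\beta)$ and $\forall m(m\succ\beta\Rightarrow m\succ\alpha)$; an s-hypersequent is satisfied iff some component is; true in $\mathbb{KC}$ iff satisfied in every model based on $\mathbb{KC}$; valid in a class iff true in each member. -}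

module Defs where

open import Data.Nat using (ℕ)
open import Data.List using (List; []; _∷_; [_]; _++_)
open import Data.List.Relation.Unary.Any using (Any)
open import Data.Product using (_×_; _,_)
open import Data.Sum using (_⊎_)
open import Relation.Nullary using (¬_)
open import Function.Bundles using (_⇔_)

infixr 7 _⊓_
infixr 6 _⊔_

data Fm : Set where
  ov  : ℕ → Fm
  pv  : ℕ → Fm
  ⊤f  : Fm
  ⊥f  : Fm
  _⊓_ : Fm → Fm → Fm
  _⊔_ : Fm → Fm → Fm
  ¬f  : Fm → Fm
  ⌟f  : Fm → Fm
  □f  : Fm → Fm
  ■f  : Fm → Fm

_∨f_ : Fm → Fm → Fm
a ∨f b = ¬f (¬f a ⊓ ¬f b)

_∧f_ : Fm → Fm → Fm
a ∧f b = ⌟f (⌟f a ⊔ ⌟f b)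

infix 4 _⊢_
record Seq : Set where
  constructor _⊢_
  field
    lhs : Fm
    rhs : Fm

HSeq : Set
HSeq = List Seq

-- Single-sequent axioms of MPDBL (α ⊣⊢ β gives two constructors)

data Ax : Fm → Fm → Set where
  a-id    : ∀ a → Ax a a
  a-⊓l    : ∀ a b → Ax (a ⊓ b) a
  a-⊓r    : ∀ a b → Ax (a ⊓ b) b
  a-⊔l    : ∀ a b → Ax a (a ⊔ b)
  a-⊔r    : ∀ a b → Ax b (a ⊔ b)
  a-⊓dup  : ∀ a b → Ax (a ⊓ b) ((a ⊓ b) ⊓ (a ⊓ b))
  a-⊔dup  : ∀ a b → Ax ((a ⊔ b) ⊔ (a ⊔ b)) (a ⊔ b)
  a-¬⊓    : ∀ a → Ax (¬f (a ⊓ a)) (¬f a)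
  a-⌟⊔    : ∀ a → Ax (⌟f a) (⌟f (a ⊔ a))
  a-contr : ∀ a → Ax (a ⊓ ¬f a) ⊥f
  a-tnd   : ∀ a → Ax ⊤f (a ⊔ ⌟f a)
  a-¬¬₁   : ∀ a b → Ax (¬f (¬f (a ⊓ b))) (a ⊓ b)
  a-¬¬₂   : ∀ a b → Ax (a ⊓ b) (¬f (¬f (a ⊓ b)))
  a-⌟⌟₁   : ∀ a b → Ax (⌟f (⌟f (a ⊔ b))) (a ⊔ b)
  a-⌟⌟₂   : ∀ a b → Ax (a ⊔ b) (⌟f (⌟f (a ⊔ b)))
  a-abs1  : ∀ a b → Ax (a ⊓ a) (a ⊓ (a ⊔ b))
  a-abs2  : ∀ a b → Ax (a ⊔ (a ⊓ b)) (a ⊔ a)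
  a-abs3  : ∀ a b → Ax (a ⊓ a) (a ⊓ (a ∨f b))
  a-abs4  : ∀ a b → Ax (a ⊔ (a ∧f b)) (a ⊔ a)
  a-dist1₁ : ∀ a b c → Ax (a ⊓ (b ∨f c)) ((a ⊓ b) ∨f (a ⊓ c))
  a-dist1₂ : ∀ a b c → Ax ((a ⊓ b) ∨f (a ⊓ c)) (a ⊓ (b ∨f c))
  a-dist2₁ : ∀ a b c → Ax (a ⊔ (b ∧f c)) ((a ⊔ b) ∧f (a ⊔ c))
  a-dist2₂ : ∀ a b c → Ax ((a ⊔ b) ∧f (a ⊔ c)) (a ⊔ (b ∧f c))
  a-⊥     : ∀ a → Ax ⊥f a
  a-⊤     : ∀ a → Ax a ⊤f
  a-¬⊤    : Ax (¬f ⊤f) ⊥f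
  a-⌟⊥    : Ax ⊤f (⌟f ⊥f)
  a-¬⊥₁   : Ax (¬f ⊥f) (⊤f ⊓ ⊤f)
  a-¬⊥₂   : Ax (⊤f ⊓ ⊤f) (¬f ⊥f)
  a-⌟⊤₁   : Ax (⌟f ⊤f) (⊥f ⊔ ⊥f)
  a-⌟⊤₂   : Ax (⊥f ⊔ ⊥f) (⌟f ⊤f)
  a-mix₁  : ∀ a → Ax ((a ⊔ a) ⊓ (a ⊔ a)) ((a ⊓ a) ⊔ (a ⊓ a))
  a-mix₂  : ∀ a → Ax ((a ⊓ a) ⊔ (a ⊓ a)) ((a ⊔ a) ⊓ (a ⊔ a))
  a-ov₁   : ∀ n → Ax (ov n ⊓ ov n) (ov n)
  a-ov₂   : ∀ n → Ax (ov n) (ov n ⊓ ov n)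
  a-pv₁   : ∀ n → Ax (pv n ⊔ pv n) (pv n)
  a-pv₂   : ∀ n → Ax (pv n) (pv n ⊔ pv n)
  m-□⊓₁   : ∀ a b → Ax (□f a ⊓ □f b) (□f (a ⊓ b))
  m-□⊓₂   : ∀ a b → Ax (□f (a ⊓ b)) (□f a ⊓ □f b)
  m-■⊔₁   : ∀ a b → Ax (■f a ⊔ ■f b) (■f (a ⊔ b))
  m-■⊔₂   : ∀ a b → Ax (■f (a ⊔ b)) (■f a ⊔ ■f b)
  m-□¬⊥₁  : Ax (□f (¬f ⊥f)) (¬f ⊥f)
  m-□¬⊥₂  : Ax (¬f ⊥f) (□f (¬f ⊥f))
  m-■⌟⊤₁  : Ax (■f (⌟f ⊤f)) (⌟f ⊤f)
  m-■⌟⊤₂  : Ax (⌟f ⊤f) (■f (⌟f ⊤f))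
  m-□idem₁ : ∀ a → Ax (□f (a ⊓ a)) (□f a)
  m-□idem₂ : ∀ a → Ax (□f a) (□f (a ⊓ a))
  m-■idem₁ : ∀ a → Ax (■f (a ⊔ a)) (■f a)
  m-■idem₂ : ∀ a → Ax (■f a) (■f (a ⊔ a))

data Prov : HSeq → Set where
  ax    : ∀ {a b} → Ax a b → Prov [ a ⊢ b ]
  sp    : ∀ a → Prov ((a ⊢ a ⊓ a) ∷ (a ⊔ a ⊢ a) ∷ [])
  r-⊓ʳ  : ∀ B C a b c → Prov (B ++ (a ⊢ b) ∷ C) → Prov (B ++ (a ⊓ c ⊢ b ⊓ c) ∷ C)
  r-⊓ˡ  : ∀ B C a b c → Prov (B ++ (a ⊢ b) ∷ C) → Prov (B ++ (c ⊓ a ⊢ c ⊓ b) ∷ C)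
  r-⊔ʳ  : ∀ B C a b c → Prov (B ++ (a ⊢ b) ∷ C) → Prov (B ++ (a ⊔ c ⊢ b ⊔ c) ∷ C)
  r-⊔ˡ  : ∀ B C a b c → Prov (B ++ (a ⊢ b) ∷ C) → Prov (B ++ (c ⊔ a ⊢ c ⊔ b) ∷ C)
  r-¬   : ∀ B C a b → Prov (B ++ (a ⊢ b) ∷ C) → Prov (B ++ (¬f b ⊢ ¬f a) ∷ C)
  r-⌟   : ∀ B C a b → Prov (B ++ (a ⊢ b) ∷ C) → Prov (B ++ (⌟f b ⊢ ⌟f a) ∷ C)
  r-□   : ∀ B C a b → Prov (B ++ (a ⊢ b) ∷ C) → Prov (B ++ (□f a ⊢ □f b) ∷ C)
  r-■   : ∀ B C a b → Prov (B ++ (a ⊢ b) ∷ C) → Prov (B ++ (■f a ⊢ ■f b) ∷ C)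
  cut   : ∀ B C D E a b c →
          Prov (B ++ (a ⊢ b) ∷ C) → Prov (D ++ (b ⊢ c) ∷ E) →
          Prov (B ++ D ++ (a ⊢ c) ∷ C ++ E)
  r-eq  : ∀ B C D E F G H X a b →
          Prov (B ++ (a ⊓ b ⊢ a ⊓ a) ∷ C) →
          Prov (D ++ (a ⊓ a ⊢ a ⊓ b) ∷ E) →
          Prov (F ++ (a ⊔ b ⊢ b ⊔ b) ∷ G) →
          Prov (H ++ (b ⊔ b ⊢ a ⊔ b) ∷ X) →
          Prov (B ++ D ++ F ++ H ++ (a ⊢ b) ∷ C ++ E ++ G ++ X)
  e-con : ∀ B D C → Prov (B ++ D ++ D ++ C) → Prov (B ++ D ++ C)
  e-exc : ∀ B D E C → Prov (B ++ D ++ E ++ C) → Prov (B ++ E ++ D ++ C)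
  e-wk  : ∀ B C → Prov B → Prov (B ++ C)

record KripkeContext : Set₁ where
  field
    G : Set
    M : Set
    I : G → M → Set
    R : G → G → Set
    S : M → M → Set

module _ (K : KripkeContext) where
  open KripkeContext K

  _′ᴳ : (G → Set) → (M → Set)
  (A ′ᴳ) m = ∀ g → A g → I g m

  _′ᴹ : (M → Set) → (G → Set)
  (B ′ᴹ) g = ∀ m → B m → I g m

  record Pair : Set₁ where
    constructor ⟨_,_⟩
    field
      ext : G → Set
      int : M → Set
  open Pair public

  _≅_ : Pair → Pair → Set
  X ≅ Y = (∀ g → ext X g ⇔ ext Y g) × (∀ m → int X m ⇔ int Y m)

  IsSemiconcept : Pair → Set
  IsSemiconcept X = (∀ m → (ext X ′ᴳ) m ⇔ int X m) ⊎ (∀ g → (int X ′ᴹ) g ⇔ ext X g)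

  _⊓ₛ_ : Pair → Pair → Pair
  X ⊓ₛ Y = ⟨ (λ g → ext X g × ext Y g) , (λ g → ext X g × ext Y g) ′ᴳ ⟩

  _⊔ₛ_ : Pair → Pair → Pair
  X ⊔ₛ Y = ⟨ (λ m → int X m × int Y m) ′ᴹ , (λ m → int X m × int Y m) ⟩

  -- a valuation; v(⊤) = (G , ∅) and v(⊥) = (∅ , M) are built into
  -- the satisfaction clauses below
  record Valuation : Set₁ where
    field
      vO     : ℕ → Pair
      vP     : ℕ → Pair
      vO-sc  : ∀ n → IsSemiconcept (vO n)
      vP-sc  : ∀ n → IsSemiconcept (vP n)
      vO-idem : ∀ n → (vO n ⊓ₛ vO n) ≅ vO n
      vP-idem : ∀ n → (vP n ⊔ₛ vP n) ≅ vP n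

  module _ (v : Valuation) where
    open Valuation v

    sat   : G → Fm → Set
    cosat : M → Fm → Set

    sat g (ov n)  = ext (vO n) g
    sat g (pv n)  = ext (vP n) g
    sat g ⊤f      = ⊤′ where open import Data.Unit using () renaming (⊤ to ⊤′)
    sat g ⊥f      = ⊥′ where open import Data.Empty using () renaming (⊥ to ⊥′)
    sat g (a ⊓ b) = sat g a × sat g b
    sat g (a ⊔ b) = ∀ m → (cosat m a × cosat m b) → I g m
    sat g (¬f a)  = ¬ sat g a
    sat g (⌟f a)  = ∀ m → ¬ cosat m a → I g m
    sat g (□f a)  = ∀ g₁ → R g g₁ → sat g₁ a
    sat g (■f a)  = ∀ m → (∀ m₁ → S m m₁ → cosat m₁ a) → I g m

    cosat m (ov n)  = int (vO n) m
    cosat m (pv n)  = int (vP n) m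
    cosat m ⊤f      = ⊥′ where open import Data.Empty using () renaming (⊥ to ⊥′)
    cosat m ⊥f      = ⊤′ where open import Data.Unit using () renaming (⊤ to ⊤′)
    cosat m (a ⊓ b) = ∀ g → (sat g a × sat g b) → I g m
    cosat m (a ⊔ b) = cosat m a × cosat m b
    cosat m (¬f a)  = ∀ g → ¬ sat g a → I g m
    cosat m (⌟f a)  = ¬ cosat m a
    cosat m (□f a)  = ∀ g → (∀ g₁ → R g g₁ → sat g₁ a) → I g m
    cosat m (■f a)  = ∀ m₁ → S m m₁ → cosat m₁ a

    SeqSat : Seq → Set
    SeqSat (a ⊢ b) = (∀ g → sat g a → sat g b) × (∀ m → cosat m b → cosat m a)

    HSat : HSeq → Set
    HSat H = Any SeqSat H

ValidKC : HSeq → Set₁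
ValidKC H = (K : KripkeContext) (v : Valuation K) → HSat K v H

{-# OPTIONS --safe #-}
module Submission where

open import Defs
open import Axiom.ExcludedMiddle using (ExcludedMiddle)
open import Axiom.DoubleNegationElimination using (DoubleNegationElimination; em⇒dne)
open import Level using (0ℓ)
open import Data.List using (_∷_; _++_)
open import Data.List.Membership.Propositional using (lose)
open import Data.List.Membership.Propositional.Properties using (∈-++⁺ʳ; ∈-insert)
open import Data.List.Relation.Unary.Any as Any using (Any; here; there)
import Data.List.Relation.Unary.Any.Properties as Anyₚ
open import Data.List.Relation.Binary.Sublist.Propositional using (_⊆_; _∷ʳ_; ⊆-refl)
open import Data.List.Relation.Binary.Sublist.Propositional.Properties
  using (Any-resp-⊆; ++⁺; ++⁺ˡ; ++⁺ʳ)
open import Data.List.Relation.Binary.Permutation.Propositional.Properties as ↭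
  using (Any-resp-↭; shift; shifts)
open import Data.Product using (_,_; proj₁; proj₂)
open import Data.Sum using (_⊎_; inj₁; inj₂)
open import Data.Unit using (tt)
open import Function.Bundles using (module Equivalence)

-- Every formula denotes a semiconcept of the context: a ⊓-semiconcept (A , A′)
-- or a ⊔-semiconcept (B′ , B); in either case its extent and intent are
-- incident.  Consequently, when a is a ⊓-semiconcept, a ⊢ b holds as soon as
-- the extent of a is contained in that of b, and dually, when b is a
-- ⊔-semiconcept, only the intents need comparing.  For nearly every axiom and
-- rule of MPDBL one of the two applies, so its soundness reduces to a single
-- inclusion.  Excluded middle is needed only for the double-negation and
-- distributive axioms.

module _ {A : Set} {P : A → Set} where

  Any-focus : ∀ B {x C} → Any P (B ++ x ∷ C) → P x ⊎ Any P (B ++ C)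
  Any-focus B {x} {C} p with Any-resp-↭ (shift x B C) p
  ... | here px = inj₁ px
  ... | there q = inj₂ q

  Any-replace : ∀ B {x y C} → (P x → P y) → Any P (B ++ x ∷ C) → Any P (B ++ y ∷ C)
  Any-replace B f p with Any-focus B p
  ... | inj₁ px = lose (∈-insert B) (f px)
  ... | inj₂ q  = Any-resp-⊆ (++⁺ ⊆-refl (_ ∷ʳ ⊆-refl)) q

  Any-contract : ∀ B D {C} → Any P (B ++ D ++ D ++ C) → Any P (B ++ D ++ C)
  Any-contract B D p with Anyₚ.++⁻ B p
  ... | inj₁ q = Anyₚ.++⁺ˡ q
  ... | inj₂ q with Anyₚ.++⁻ D q
  ...   | inj₁ r = Anyₚ.++⁺ʳ B (Anyₚ.++⁺ˡ r)
  ...   | inj₂ r = Anyₚ.++⁺ʳ B r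

module Semantics (K : KripkeContext) (v : Valuation K) where
  open KripkeContext K
  open Valuation v

  infix 4 _⊨_ _≻_ _≼_

  _⊨_ : G → Fm → Set
  _⊨_ = sat K v

  _≻_ : M → Fm → Set
  _≻_ = cosat K v

  -- A record, unlike SeqSat, keeps a and b inferable from the type.
  record _≼_ (a b : Fm) : Set where
    constructor _,_
    field
      ext-⊆ : ∀ g → g ⊨ a → g ⊨ b
      int-⊇ : ∀ m → m ≻ b → m ≻ a

  Satisfied : Seq → Set
  Satisfied (a ⊢ b) = a ≼ b

  Satisfied⇒SeqSat : ∀ {s} → Satisfied s → SeqSat K v s
  Satisfied⇒SeqSat (ext , int) = ext , int

  ⊨≻⇒I : ∀ a {g m} → g ⊨ a → m ≻ a → I g m
  ⊨≻⇒I (ov n) {g} {m} s c = Equivalence.from (proj₂ (vO-idem n) m) c g (s , s)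
  ⊨≻⇒I (pv n) {g} {m} s c = Equivalence.from (proj₁ (vP-idem n) g) s m (c , c)
  ⊨≻⇒I ⊤f      _ ()
  ⊨≻⇒I ⊥f      ()
  ⊨≻⇒I (a ⊓ b) s c = c _ s
  ⊨≻⇒I (a ⊔ b) s c = s _ c
  ⊨≻⇒I (¬f a)  s c = c _ s
  ⊨≻⇒I (⌟f a)  s c = s _ c
  ⊨≻⇒I (□f a)  s c = c _ s
  ⊨≻⇒I (■f a)  s c = s _ c

  -- Together with ⊨≻⇒I these say that the intent is the derivation of the
  -- extent, resp. the extent the derivation of the intent.
  ⊓-Semiconcept : Fm → Set
  ⊓-Semiconcept a = ∀ m → (∀ g → g ⊨ a → I g m) → m ≻ a

  ⊔-Semiconcept : Fm → Set
  ⊔-Semiconcept a = ∀ g → (∀ m → m ≻ a → I g m) → g ⊨ a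

  ov-semiconcept : ∀ n → ⊓-Semiconcept (ov n)
  ov-semiconcept n m h = Equivalence.to (proj₂ (vO-idem n) m) (λ g (s , _) → h g s)

  pv-semiconcept : ∀ n → ⊔-Semiconcept (pv n)
  pv-semiconcept n g h = Equivalence.to (proj₁ (vP-idem n) g) (λ m (c , _) → h m c)

  semiconcept : ∀ a → ⊓-Semiconcept a ⊎ ⊔-Semiconcept a
  semiconcept (ov n)  = inj₁ (ov-semiconcept n)
  semiconcept (pv n)  = inj₂ (pv-semiconcept n)
  semiconcept ⊤f      = inj₂ (λ _ _ → tt)
  semiconcept ⊥f      = inj₁ (λ _ _ → tt)
  semiconcept (a ⊓ b) = inj₁ (λ _ h → h)
  semiconcept (a ⊔ b) = inj₂ (λ _ h → h)
  semiconcept (¬f a)  = inj₁ (λ _ h → h)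
  semiconcept (⌟f a)  = inj₂ (λ _ h → h)
  semiconcept (□f a)  = inj₁ (λ _ h → h)
  semiconcept (■f a)  = inj₂ (λ _ h → h)

  int′-ext′⇒I : ∀ a {g m} → (∀ m′ → m′ ≻ a → I g m′) → (∀ g′ → g′ ⊨ a → I g′ m) → I g m
  int′-ext′⇒I a g∈int′ m∈ext′ with semiconcept a
  ... | inj₁ ⊓a = g∈int′ _ (⊓a _ m∈ext′)
  ... | inj₂ ⊔a = m∈ext′ _ (⊔a _ g∈int′)

  ⊨-⊔-introˡ : ∀ a b {g} → g ⊨ a → g ⊨ a ⊔ b
  ⊨-⊔-introˡ a _ s _ (c , _) = ⊨≻⇒I a s c

  ≻-⊓-introˡ : ∀ a b {m} → m ≻ a → m ≻ a ⊓ b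
  ≻-⊓-introˡ a _ c _ (s , _) = ⊨≻⇒I a s c

  ≼-refl : ∀ {a} → a ≼ a
  ≼-refl = (λ _ s → s) , (λ _ c → c)

  ≼-trans : ∀ {a b c} → a ≼ b → b ≼ c → a ≼ c
  ≼-trans (ab , ba) (bc , cb) = (λ g s → bc g (ab g s)) , (λ m c → ba m (cb m c))

  ≼-by-ext : ∀ {a b} → ⊓-Semiconcept a → (∀ g → g ⊨ a → g ⊨ b) → a ≼ b
  ≼-by-ext {b = b} ⊓a ab = ab , λ m c → ⊓a m (λ g s → ⊨≻⇒I b (ab g s) c)

  ≼-by-int : ∀ {a b} → ⊔-Semiconcept b → (∀ m → m ≻ b → m ≻ a) → a ≼ b
  ≼-by-int {a} ⊔b ba = (λ g s → ⊔b g (λ m c → ⊨≻⇒I a s (ba m c))) , ba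

  ⊓≼-by-ext : ∀ {a b c} → (∀ g → g ⊨ a ⊓ b → g ⊨ c) → a ⊓ b ≼ c
  ⊓≼-by-ext = ≼-by-ext (λ _ h → h)

  ¬≼-by-ext : ∀ {a c} → (∀ g → g ⊨ ¬f a → g ⊨ c) → ¬f a ≼ c
  ¬≼-by-ext = ≼-by-ext (λ _ h → h)

  □≼-by-ext : ∀ {a c} → (∀ g → g ⊨ □f a → g ⊨ c) → □f a ≼ c
  □≼-by-ext = ≼-by-ext (λ _ h → h)

  ≼⊔-by-int : ∀ {a b c} → (∀ m → m ≻ b ⊔ c → m ≻ a) → a ≼ b ⊔ c
  ≼⊔-by-int = ≼-by-int (λ _ h → h)

  ≼⌟-by-int : ∀ {a b} → (∀ m → m ≻ ⌟f b → m ≻ a) → a ≼ ⌟f b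
  ≼⌟-by-int = ≼-by-int (λ _ h → h)

  ≼■-by-int : ∀ {a b} → (∀ m → m ≻ ■f b → m ≻ a) → a ≼ ■f b
  ≼■-by-int = ≼-by-int (λ _ h → h)

  ⊓-monoˡ-≼ : ∀ {a b} c → a ≼ b → a ⊓ c ≼ b ⊓ c
  ⊓-monoˡ-≼ _ (ab , _) = ⊓≼-by-ext λ g (s , t) → ab g s , t

  ⊓-monoʳ-≼ : ∀ {a b} c → a ≼ b → c ⊓ a ≼ c ⊓ b
  ⊓-monoʳ-≼ _ (ab , _) = ⊓≼-by-ext λ g (t , s) → t , ab g s

  ⊔-monoˡ-≼ : ∀ {a b} c → a ≼ b → a ⊔ c ≼ b ⊔ c
  ⊔-monoˡ-≼ _ (_ , ba) = ≼⊔-by-int λ m (c , d) → ba m c , d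

  ⊔-monoʳ-≼ : ∀ {a b} c → a ≼ b → c ⊔ a ≼ c ⊔ b
  ⊔-monoʳ-≼ _ (_ , ba) = ≼⊔-by-int λ m (d , c) → d , ba m c

  ¬-antitone-≼ : ∀ {a b} → a ≼ b → ¬f b ≼ ¬f a
  ¬-antitone-≼ (ab , _) = ¬≼-by-ext λ g ¬b s → ¬b (ab g s)

  ⌟-antitone-≼ : ∀ {a b} → a ≼ b → ⌟f b ≼ ⌟f a
  ⌟-antitone-≼ (_ , ba) = ≼⌟-by-int λ m ¬a c → ¬a (ba m c)

  □-mono-≼ : ∀ {a b} → a ≼ b → □f a ≼ □f b
  □-mono-≼ (ab , _) = □≼-by-ext λ g s g₁ r → ab g₁ (s g₁ r)

  ■-mono-≼ : ∀ {a b} → a ≼ b → ■f a ≼ ■f b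
  ■-mono-≼ (_ , ba) = ≼■-by-int λ m c m₁ r → ba m₁ (c m₁ r)

  ≼-by-⊓-⊔ : ∀ {a b} → a ⊓ a ≼ a ⊓ b → a ⊔ b ≼ b ⊔ b → a ≼ b
  ≼-by-⊓-⊔ (ext , _) (_ , int) =
    (λ g s → proj₂ (ext g (s , s))) , (λ m c → proj₁ (int m (c , c)))

  ⊓-or-⊔-idempotent : ∀ a → a ≼ a ⊓ a ⊎ a ⊔ a ≼ a
  ⊓-or-⊔-idempotent a with semiconcept a
  ... | inj₁ ⊓a = inj₁ (≼-by-ext ⊓a λ _ s → s , s)
  ... | inj₂ ⊔a = inj₂ (≼-by-int ⊔a λ _ c → c , c)

  module _ (dne : DoubleNegationElimination 0ℓ) where

    Ax⇒≼ : ∀ {a b} → Ax a b → a ≼ b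
    Ax⇒≼ (a-id a)     = ≼-refl
    Ax⇒≼ (a-⊓l a b)   = ⊓≼-by-ext λ _ → proj₁
    Ax⇒≼ (a-⊓r a b)   = ⊓≼-by-ext λ _ → proj₂
    Ax⇒≼ (a-⊔l a b)   = ≼⊔-by-int λ _ → proj₁
    Ax⇒≼ (a-⊔r a b)   = ≼⊔-by-int λ _ → proj₂
    Ax⇒≼ (a-⊓dup a b) = ⊓≼-by-ext λ _ s → s , s
    Ax⇒≼ (a-⊔dup a b) = ≼⊔-by-int λ _ c → c , c
    Ax⇒≼ (a-¬⊓ a)     = ¬≼-by-ext λ _ ¬aa s → ¬aa (s , s)
    Ax⇒≼ (a-⌟⊔ a)     = ≼⌟-by-int λ _ ¬aa c → ¬aa (c , c)
    Ax⇒≼ (a-contr a)  = ⊓≼-by-ext λ _ (s , ¬s) → ¬s s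
    Ax⇒≼ (a-tnd a)    = ≼⊔-by-int λ _ (c , ¬c) → ¬c c
    Ax⇒≼ (a-¬¬₁ a b)  = ¬≼-by-ext λ _ → dne
    Ax⇒≼ (a-¬¬₂ a b)  = ⊓≼-by-ext λ _ s ¬s → ¬s s
    Ax⇒≼ (a-⌟⌟₁ a b)  = ≼⊔-by-int λ _ c ¬c → ¬c c
    Ax⇒≼ (a-⌟⌟₂ a b)  = ≼⌟-by-int λ _ → dne
    Ax⇒≼ (a-abs1 a b) = ⊓≼-by-ext λ _ (s , _) → s , ⊨-⊔-introˡ a b s
    Ax⇒≼ (a-abs2 a b) = ≼⊔-by-int λ _ (c , _) → c , ≻-⊓-introˡ a b c
    Ax⇒≼ (a-abs3 a b) = ⊓≼-by-ext λ _ (s , _) → s , λ (¬s , _) → ¬s s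
    Ax⇒≼ (a-abs4 a b) = ≼⊔-by-int λ _ (c , _) → c , λ (¬c , _) → ¬c c
    Ax⇒≼ (a-dist1₁ a b c) = ⊓≼-by-ext λ _ (s , ¬¬b∨c) (¬ab , ¬ac) →
      ¬¬b∨c ((λ t → ¬ab (s , t)) , (λ t → ¬ac (s , t)))
    Ax⇒≼ (a-dist1₂ a b c) = ¬≼-by-ext λ _ ¬¬ab∨ac →
        dne (λ ¬s → ¬¬ab∨ac ((λ (s , _) → ¬s s) , (λ (s , _) → ¬s s)))
      , (λ (¬b , ¬c) → ¬¬ab∨ac ((λ (_ , t) → ¬b t) , (λ (_ , t) → ¬c t)))
    Ax⇒≼ (a-dist2₁ a b c) = ≼⌟-by-int λ _ ¬¬ab∧ac →
        dne (λ ¬c → ¬¬ab∧ac ((λ (c , _) → ¬c c) , (λ (c , _) → ¬c c)))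
      , (λ (¬b , ¬d) → ¬¬ab∧ac ((λ (_ , t) → ¬b t) , (λ (_ , t) → ¬d t)))
    Ax⇒≼ (a-dist2₂ a b c) = ≼⊔-by-int λ _ (c , ¬¬b∧c) (¬ab , ¬ac) →
      ¬¬b∧c ((λ t → ¬ab (c , t)) , (λ t → ¬ac (c , t)))
    Ax⇒≼ (a-⊥ a)      = (λ _ ()) , (λ _ _ → tt)
    Ax⇒≼ (a-⊤ a)      = (λ _ _ → tt) , (λ _ ())
    Ax⇒≼ a-¬⊤         = ¬≼-by-ext λ _ ¬⊤ → ¬⊤ tt
    Ax⇒≼ a-⌟⊥         = ≼⌟-by-int λ _ ¬⊥ → ¬⊥ tt
    Ax⇒≼ a-¬⊥₁        = ¬≼-by-ext λ _ _ → tt , tt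
    Ax⇒≼ a-¬⊥₂        = ⊓≼-by-ext λ _ _ ()
    Ax⇒≼ a-⌟⊤₁        = ≼⊔-by-int λ _ _ ()
    Ax⇒≼ a-⌟⊤₂        = ≼⌟-by-int λ _ _ → tt , tt
    Ax⇒≼ (a-mix₁ a)   = ⊓≼-by-ext λ _ (s , _) m (c , _) →
      int′-ext′⇒I a (λ m′ c′ → s m′ (c′ , c′)) (λ g′ s′ → c g′ (s′ , s′))
    Ax⇒≼ (a-mix₂ a)   =
        (λ g s → let s′ = λ m (c , _) → s m (≻-⊓-introˡ a a c , ≻-⊓-introˡ a a c) in s′ , s′)
      , (λ m c → let c′ = λ g (s , _) → c g (⊨-⊔-introˡ a a s , ⊨-⊔-introˡ a a s) in c′ , c′)
    Ax⇒≼ (a-ov₁ n)    = ⊓≼-by-ext λ _ → proj₁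
    Ax⇒≼ (a-ov₂ n)    = ≼-by-ext (ov-semiconcept n) λ _ s → s , s
    Ax⇒≼ (a-pv₁ n)    = ≼-by-int (pv-semiconcept n) λ _ c → c , c
    Ax⇒≼ (a-pv₂ n)    = ≼⊔-by-int λ _ → proj₁
    Ax⇒≼ (m-□⊓₁ a b)  = ⊓≼-by-ext λ _ (s , t) g₁ r → s g₁ r , t g₁ r
    Ax⇒≼ (m-□⊓₂ a b)  = □≼-by-ext λ _ s → (λ g₁ r → proj₁ (s g₁ r)) , (λ g₁ r → proj₂ (s g₁ r))
    Ax⇒≼ (m-■⊔₁ a b)  = ≼■-by-int λ _ c → (λ m₁ r → proj₁ (c m₁ r)) , (λ m₁ r → proj₂ (c m₁ r))
    Ax⇒≼ (m-■⊔₂ a b)  = ≼⊔-by-int λ _ (c , d) m₁ r → c m₁ r , d m₁ r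
    Ax⇒≼ m-□¬⊥₁       = □≼-by-ext λ _ _ ()
    Ax⇒≼ m-□¬⊥₂       = ¬≼-by-ext λ _ _ _ _ ()
    Ax⇒≼ m-■⌟⊤₁       = ≼⌟-by-int λ _ _ _ _ ()
    Ax⇒≼ m-■⌟⊤₂       = ≼■-by-int λ _ _ ()
    Ax⇒≼ (m-□idem₁ a) = □≼-by-ext λ _ s g₁ r → proj₁ (s g₁ r)
    Ax⇒≼ (m-□idem₂ a) = □≼-by-ext λ _ s g₁ r → s g₁ r , s g₁ r
    Ax⇒≼ (m-■idem₁ a) = ≼■-by-int λ _ c m₁ r → c m₁ r , c m₁ r
    Ax⇒≼ (m-■idem₂ a) = ≼■-by-int λ _ c m₁ r → proj₁ (c m₁ r)

    sound : ∀ {H} → Prov H → Any Satisfied H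
    sound (ax x)                      = here (Ax⇒≼ x)
    sound (sp a) with ⊓-or-⊔-idempotent a
    ... | inj₁ a≼aa = here a≼aa
    ... | inj₂ aa≼a = there (here aa≼a)
    sound (r-⊓ʳ B C a b c d)          = Any-replace B (⊓-monoˡ-≼ c) (sound d)
    sound (r-⊓ˡ B C a b c d)          = Any-replace B (⊓-monoʳ-≼ c) (sound d)
    sound (r-⊔ʳ B C a b c d)          = Any-replace B (⊔-monoˡ-≼ c) (sound d)
    sound (r-⊔ˡ B C a b c d)          = Any-replace B (⊔-monoʳ-≼ c) (sound d)
    sound (r-¬ B C a b d)             = Any-replace B ¬-antitone-≼ (sound d)
    sound (r-⌟ B C a b d)             = Any-replace B ⌟-antitone-≼ (sound d)
    sound (r-□ B C a b d)             = Any-replace B □-mono-≼ (sound d)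
    sound (r-■ B C a b d)             = Any-replace B ■-mono-≼ (sound d)
    sound (cut B C D E a b c d₁ d₂) with Any-focus B (sound d₁) | Any-focus D (sound d₂)
    ... | inj₂ side | _ =
      Any-resp-⊆ (++⁺ (⊆-refl {x = B}) (++⁺ˡ D (_ ∷ʳ ++⁺ʳ E ⊆-refl))) side
    ... | inj₁ _ | inj₂ side =
      Any-resp-⊆ (++⁺ˡ B (++⁺ (⊆-refl {x = D}) (_ ∷ʳ ++⁺ˡ C ⊆-refl))) side
    ... | inj₁ a≼b | inj₁ b≼c =
      lose (∈-++⁺ʳ B (∈-insert D)) (≼-trans a≼b b≼c)
    sound (r-eq B C D E F G H X a b _ d₂ d₃ _) with Any-focus D (sound d₂) | Any-focus F (sound d₃)
    ... | inj₂ side | _ = Any-resp-⊆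
      (++⁺ˡ B (++⁺ (⊆-refl {x = D}) (++⁺ˡ F (++⁺ˡ H (_ ∷ʳ ++⁺ˡ C (++⁺ʳ (G ++ X) ⊆-refl))))))
      side
    ... | inj₁ _ | inj₂ side = Any-resp-⊆
      (++⁺ˡ B (++⁺ˡ D (++⁺ (⊆-refl {x = F}) (++⁺ˡ H (_ ∷ʳ ++⁺ˡ C (++⁺ˡ E (++⁺ʳ X ⊆-refl)))))))
      side
    ... | inj₁ aa≼ab | inj₁ ab≼bb =
      lose (∈-++⁺ʳ B (∈-++⁺ʳ D (∈-++⁺ʳ F (∈-insert H)))) (≼-by-⊓-⊔ aa≼ab ab≼bb)
    sound (e-con B D C d)             = Any-contract B D (sound d)
    sound (e-exc B D E C d)           = Any-resp-↭ (↭.++⁺ˡ B (shifts D E)) (sound d)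
    sound (e-wk B C d)                = Any-resp-⊆ (++⁺ʳ C ⊆-refl) (sound d)

theorem79 : ExcludedMiddle 0ℓ → (H : HSeq) → Prov H → ValidKC H
theorem79 em H d K v = Any.map Satisfied⇒SeqSat (sound (em⇒dne em) d)
  where open Semantics K v
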